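{- Let $G=(U,W)$ be a finite, simple, connected bipartite graph with $\delta(G)\ge 3$. If there exists a vertex $u$ with $d(u)=\delta(G)$ such that $G-u-N(u)$ (obtained by deleting $u$ and all its neighbors) is connected, then $G$ admits a vertex-coloring $2$-edge-weighting.
   Context: A $k$-edge-weighting of $G$ is a map $w:E(G)\to\{1,\dots,k\}$; it induces the vertex coloring $c(x)=\sum_{e\ni x} w(e)$ for $x\in V(G)$. The edge-weighting is vertex-coloring if $c(x)\ne c(y)$ for every edge $xy\in E(G)$. $\delta(G)$ is the minimum degree and $N(u)$ the set of neighbors of $u$. -}

module Defs where

open import Data.Nat using (ℕ; zero; suc; _+_; _≤_)
open import Data.Fin using (Fin)
open import Data.Bool using (Bool; true; false; if_then_else_; T; not; _∧_)
open import Data.List using (List; map; allFin)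
open import Data.Nat.ListAction using (sum)
open import Data.Product using (_×_; Σ)
open import Relation.Binary.PropositionalEquality using (_≡_; _≢_)
open import Relation.Nullary using (¬_)

record Graph (n : ℕ) : Set where
  field
    adj       : Fin n → Fin n → Bool
    adj-sym   : ∀ x y → adj x y ≡ adj y x
    adj-irref : ∀ x → adj x x ≡ false
open Graph public

Adj : ∀ {n} → Graph n → Fin n → Fin n → Set
Adj G x y = T (adj G x y)

Σv : ∀ {n} → (Fin n → ℕ) → ℕ
Σv {n} f = sum (map f (allFin n))

deg : ∀ {n} → Graph n → Fin n → ℕ
deg G x = Σv (λ y → if adj G x y then 1 else 0)

-- G is bipartite: there is a bipartition (U = side false, W = side true)
-- with every edge joining U and W.
Bipartite : ∀ {n} → Graph n → Set
Bipartite {n} G = Σ (Fin n → Bool) λ side → ∀ x y → Adj G x y → side x ≢ side y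

data Walk {n} (G : Graph n) (S : Fin n → Bool) : Fin n → Fin n → Set where
  here : ∀ {x} → T (S x) → Walk G S x x
  step : ∀ {x y z} → T (S x) → Adj G x y → Walk G S y z → Walk G S x z

ConnectedOn : ∀ {n} → Graph n → (Fin n → Bool) → Set
ConnectedOn {n} G S = ∀ (x y : Fin n) → T (S x) → T (S y) → Walk G S x y

Connected : ∀ {n} → Graph n → Set
Connected G = ConnectedOn G (λ _ → true)

deleteClosedNbhd : ∀ {n} → Graph n → Fin n → Fin n → Bool
deleteClosedNbhd G u x = not (adj G u x) ∧ not (isEq u x)
  where
  open import Data.Fin using (_≟_)
  open import Relation.Nullary using (does)
  isEq : _ → _ → Bool
  isEq a b = does (a ≟ b)

MinDegreeVertex : ∀ {n} → Graph n → Fin n → Set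
MinDegreeVertex {n} G u = ∀ (v : Fin n) → deg G u ≤ deg G v

MinDegreeAtLeast : ∀ {n} → Graph n → ℕ → Set
MinDegreeAtLeast {n} G k = ∀ (v : Fin n) → k ≤ deg G v

-- A k-edge-weighting: weights on ordered pairs, symmetric on edges, values in {1..k}
-- on edges (values on non-edges are irrelevant).
record EdgeWeighting {n} (G : Graph n) (k : ℕ) : Set where
  field
    w       : Fin n → Fin n → ℕ
    w-sym   : ∀ x y → Adj G x y → w x y ≡ w y x
    w-range : ∀ x y → Adj G x y → (1 ≤ w x y) × (w x y ≤ k)
open EdgeWeighting public

colour : ∀ {n} {G : Graph n} {k} → EdgeWeighting G k → Fin n → ℕ
colour {G = G} ω x = Σv (λ y → if adj G x y then w ω x y else 0)

VertexColouring : ∀ {n} {G : Graph n} {k} → EdgeWeighting G k → Set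
VertexColouring {n} {G} ω = ∀ (x y : Fin n) → Adj G x y → colour ω x ≢ colour ω y

HasVertexColouringWeighting : ∀ {n} → Graph n → ℕ → Set
HasVertexColouringWeighting G k = Σ (EdgeWeighting G k) VertexColouring

-- With weights in {1, 2}, the parity of a colour is the number of weight-1 edges at the vertex,
-- mod 2. Flipping the weights along a walk changes these parities exactly at its two ends, so
-- inside a connected vertex set every parity pattern that agrees with the current one outside the
-- set and has even total can be realised (the total of the current parities is even by the
-- handshake lemma). Take u on the side U of the bipartition (U, W). If "odd exactly on W" or
-- "odd exactly on U" has even total, realise it in the connected G: adjacent colours then differ
-- in parity. Otherwise weight by 1 the edges at u and by 2 the other edges at N(u), except that,
-- when d(u) is even, every v ∈ N(u) keeps one more edge of weight 1. Then
-- c(u) = d(u) < 2 d(v) - 2 ≤ c(v) for v ∈ N(u), and the parities at u and N(u) agree with the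
-- pattern that is odd exactly on W (d(u) odd) or on U (d(u) even) away from u and equals the
-- parity of d(u) at u; this pattern has even total, so it is realised inside the connected
-- G - u - N(u) without changing the colours of u and N(u).

module Submission where

open import Defs
open import Algebra.Bundles using (Monoid; Semiring; CommutativeRing)
import Algebra.Properties.Monoid.Sum as MonoidSum
import Algebra.Properties.Semiring.Sum as SemiringSum
open import Data.Bool using (Bool; true; false; not; _∧_; _∨_; _xor_; if_then_else_; T)
open import Data.Bool.Properties
  using ( xor-∧-commutativeRing; xor-assoc; xor-comm; xor-same; xor-identityʳ; xor-inverseˡ
        ; not-distribˡ-xor; ∧-distribˡ-xor; ∧-comm; ∧-zeroʳ; ∧-identityʳ; ∨-comm; ∨-identityʳ
        ; not-involutive; ¬-not; T-≡; T-∧ )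
open import Data.Empty using (⊥-elim)
open import Data.Fin using (Fin; zero; suc; _≟_)
open import Data.Fin.Properties using (any?; suc-injective)
open import Data.List using (tabulate; allFin)
open import Data.List.Properties using (map-tabulate; map-cong)
open import Data.Nat using (ℕ; zero; suc; _+_; _≤_; _<_; z≤n; s≤s)
import Data.Nat.ListAction as List
import Data.Nat.Properties as ℕ
open import Data.Product using (Σ; ∃; _×_; _,_; proj₁; proj₂)
open import Function using (_∘_; id)
open import Function.Bundles using (Equivalence)
open import Relation.Binary.PropositionalEquality
open import Relation.Nullary using (¬_; Dec; yes; no; does; _×-dec_; ¬?)
open import Relation.Nullary.Decidable using (dec-true; dec-false; T?)

module _ {a ℓ} (M : Monoid a ℓ) where
  open Monoid M using (Carrier; _≈_; ε; ∙-congˡ; ∙-congʳ; identityˡ; identityʳ) renaming (trans to ≈-trans)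
  open MonoidSum M using (sum; sum-cong-≋; sum-replicate-zero)

  sum-single : ∀ {n} (f : Fin n → Carrier) c → (∀ x → x ≢ c → f x ≈ ε) → sum f ≈ f c
  sum-single {suc n} f zero f≈ε =
    ≈-trans (∙-congˡ (≈-trans (sum-cong-≋ (λ x → f≈ε (suc x) λ ())) (sum-replicate-zero n))) (identityʳ _)
  sum-single {suc n} f (suc c) f≈ε =
    ≈-trans (∙-congʳ (f≈ε zero λ ()))
            (≈-trans (identityˡ _) (sum-single (f ∘ suc) c (λ x x≢c → f≈ε (suc x) (x≢c ∘ suc-injective))))

module ℕ∑ = SemiringSum ℕ.+-*-semiring
module ⊕∑ = SemiringSum (CommutativeRing.semiring xor-∧-commutativeRing)

∑ : ∀ {n} → (Fin n → ℕ) → ℕ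
∑ = ℕ∑.sum

⨁ : ∀ {n} → (Fin n → Bool) → Bool
⨁ = ⊕∑.sum

⨁-single : ∀ {n} (f : Fin n → Bool) c → (∀ x → x ≢ c → f x ≡ false) → ⨁ f ≡ f c
⨁-single = sum-single (Semiring.+-monoid (CommutativeRing.semiring xor-∧-commutativeRing))

∑-single : ∀ {n} (f : Fin n → ℕ) c → (∀ x → x ≢ c → f x ≡ 0) → ∑ f ≡ f c
∑-single = sum-single ℕ.+-0-monoid

∑-mono : ∀ {n} {f g : Fin n → ℕ} → (∀ x → f x ≤ g x) → ∑ f ≤ ∑ g
∑-mono {zero}  f≤g = z≤n
∑-mono {suc n} f≤g = ℕ.+-mono-≤ (f≤g zero) (∑-mono (f≤g ∘ suc))

Σv≡∑ : ∀ {n} (f : Fin n → ℕ) → Σv f ≡ ∑ f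
Σv≡∑ f = trans (cong List.sum (map-tabulate id f)) (sum-tabulate f)
  where
  sum-tabulate : ∀ {m} (g : Fin m → ℕ) → List.sum (tabulate g) ≡ ∑ g
  sum-tabulate {zero}  g = refl
  sum-tabulate {suc m} g = cong (g zero +_) (sum-tabulate (g ∘ suc))

Σv-cong : ∀ {n} {f g : Fin n → ℕ} → (∀ x → f x ≡ g x) → Σv f ≡ Σv g
Σv-cong {n} f≗g = cong List.sum (map-cong f≗g (allFin n))

_==_ : ∀ {n} → Fin n → Fin n → Bool
x == y = does (x ≟ y)

==-refl : ∀ {n} (x : Fin n) → x == x ≡ true
==-refl x = dec-true (x ≟ x) refl

==-≢ : ∀ {n} {x y : Fin n} → x ≢ y → x == y ≡ false
==-≢ {x = x} {y} = dec-false (x ≟ y)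

==⇒≡ : ∀ {n} {x y : Fin n} → T (x == y) → x ≡ y
==⇒≡ {x = x} {y} x==y with x ≟ y
... | yes x≡y = x≡y

⨁-∧-== : ∀ {n} (p : Bool) (c : Fin n) → ⨁ (λ y → p ∧ y == c) ≡ p
⨁-∧-== p c = begin
  ⨁ (λ y → p ∧ y == c) ≡⟨ ⨁-single _ c (λ y y≢c → trans (cong (p ∧_) (==-≢ y≢c)) (∧-zeroʳ p)) ⟩
  p ∧ c == c           ≡⟨ cong (p ∧_) (==-refl c) ⟩
  p ∧ true             ≡⟨ ∧-identityʳ p ⟩
  p                    ∎
  where open ≡-Reasoning

𝟙 : Bool → ℕ
𝟙 b = if b then 1 else 0

∑-𝟙-== : ∀ {n} (c : Fin n) → ∑ (λ y → 𝟙 (y == c)) ≡ 1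
∑-𝟙-== c = trans (∑-single _ c (λ y y≢c → cong 𝟙 (==-≢ y≢c))) (cong 𝟙 (==-refl c))

xor-cancelʳ : ∀ c {a b} → a xor c ≡ b xor c → a ≡ b
xor-cancelʳ c {true}  {true}  _ = refl
xor-cancelʳ c {false} {false} _ = refl
xor-cancelʳ true  {true}  {false} ()
xor-cancelʳ false {true}  {false} ()
xor-cancelʳ true  {false} {true}  ()
xor-cancelʳ false {false} {true}  ()

xor-sameˡ : ∀ p t → p xor (p xor t) ≡ t
xor-sameˡ p t = trans (sym (xor-assoc p p t)) (cong (_xor t) (xor-same p))

xor-telescope : ∀ p a b c → (p xor (a xor b)) xor (b xor c) ≡ p xor (a xor c)
xor-telescope p a b c = begin
  (p xor (a xor b)) xor (b xor c) ≡⟨ xor-assoc p _ _ ⟩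
  p xor ((a xor b) xor (b xor c)) ≡⟨ cong (p xor_) (xor-assoc a b _) ⟩
  p xor (a xor (b xor (b xor c))) ≡⟨ cong (λ q → p xor (a xor q)) (xor-sameˡ b c) ⟩
  p xor (a xor c)                 ∎
  where open ≡-Reasoning

∨≡xor : ∀ {a b} → ¬ (T a × T b) → a ∨ b ≡ a xor b
∨≡xor {true}  {true}  exclusive = ⊥-elim (exclusive _)
∨≡xor {true}  {false} _         = refl
∨≡xor {false} {b}     _         = refl

odd : ℕ → Bool
odd zero    = false
odd (suc m) = not (odd m)

odd-+ : ∀ m n → odd (m + n) ≡ odd m xor odd n
odd-+ zero    n = refl
odd-+ (suc m) n = trans (cong not (odd-+ m n)) (not-distribˡ-xor (odd m) (odd n))

odd-∑ : ∀ {n} (f : Fin n → ℕ) → odd (∑ f) ≡ ⨁ (odd ∘ f)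
odd-∑ {zero}  f = refl
odd-∑ {suc n} f = trans (odd-+ (f zero) _) (cong (odd (f zero) xor_) (odd-∑ (f ∘ suc)))

-- Each off-diagonal entry of a symmetric matrix is counted twice.
⨁⨁-symmetric : ∀ {n} (f : Fin n → Fin n → Bool) → (∀ x y → f x y ≡ f y x) → (∀ x → f x x ≡ false) →
               ⨁ (λ x → ⨁ (f x)) ≡ false
⨁⨁-symmetric {zero}  f f-sym f-irr = refl
⨁⨁-symmetric {suc n} f f-sym f-irr = begin
  (f zero zero xor R) xor ⨁ (λ x → f (suc x) zero xor ⨁ (f (suc x) ∘ suc))
    ≡⟨ cong₂ (λ a b → (a xor R) xor b) (f-irr zero)
             (⊕∑.∑-distrib-+ (λ x → f (suc x) zero) (λ x → ⨁ (f (suc x) ∘ suc))) ⟩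
  R xor (⨁ (λ x → f (suc x) zero) xor ⨁ (λ x → ⨁ (f (suc x) ∘ suc)))
    ≡⟨ cong₂ (λ a b → R xor (a xor b)) (⊕∑.sum-cong-≗ (λ x → f-sym (suc x) zero))
             (⨁⨁-symmetric (λ x y → f (suc x) (suc y)) (λ x y → f-sym (suc x) (suc y)) (f-irr ∘ suc)) ⟩
  R xor (R xor false)
    ≡⟨ xor-sameˡ R false ⟩
  false ∎
  where
  open ≡-Reasoning
  R = ⨁ (f zero ∘ suc)

module Weightings {n} (G : Graph n) where

  Adj-sym : ∀ {x y} → Adj G x y → Adj G y x
  Adj-sym {x} {y} = subst T (adj-sym G x y)

  Adj⇒≢ : ∀ {x y} → Adj G x y → x ≢ y
  Adj⇒≢ {x} xy refl = subst T (adj-irref G x) xy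

  another-neighbour : ∀ v u → 2 ≤ deg G v → ∃ λ y → Adj G v y × y ≢ u
  another-neighbour v u 2≤deg with any? (λ y → T? (adj G v y) ×-dec ¬? (y ≟ u))
  ... | yes found = found
  ... | no none   = ⊥-elim (ℕ.≤⇒≯ deg≤1 2≤deg)
    where
    only-u : ∀ y → 𝟙 (adj G v y) ≤ 𝟙 (y == u)
    only-u y with adj G v y in vy | y ≟ u
    ... | false | _       = z≤n
    ... | true  | yes _   = ℕ.≤-refl
    ... | true  | no y≢u  = ⊥-elim (none (y , Equivalence.from T-≡ vy , y≢u))

    deg≤1 : deg G v ≤ 1
    deg≤1 = begin
      deg G v                    ≡⟨ Σv≡∑ (𝟙 ∘ adj G v) ⟩
      ∑ (𝟙 ∘ adj G v)            ≤⟨ ∑-mono only-u ⟩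
      ∑ (λ y → 𝟙 (y == u))       ≡⟨ ∑-𝟙-== u ⟩
      1                          ∎
      where open ℕ.≤-Reasoning

  adj≡false⇒≢ : ∀ {z y w} → adj G z y ≡ false → Adj G z w → y ≢ w
  adj≡false⇒≢ zy≡false zw refl = subst T zy≡false zw

  -- A 2-edge-weighting is encoded by the relation "the edge has weight 2".
  Heavy : Set
  Heavy = Fin n → Fin n → Bool

  Symmetric : Heavy → Set
  Symmetric h = ∀ x y → h x y ≡ h y x

  weight : Bool → ℕ
  weight heavy = if heavy then 2 else 1

  weighting : (h : Heavy) → Symmetric h → EdgeWeighting G 2
  weighting h h-sym = record
    { w       = λ x y → weight (h x y)
    ; w-sym   = λ x y _ → cong weight (h-sym x y)
    ; w-range = λ x y _ → weight-range (h x y)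
    }
    where
    weight-range : ∀ b → 1 ≤ weight b × weight b ≤ 2
    weight-range true  = s≤s z≤n , ℕ.≤-refl
    weight-range false = ℕ.≤-refl , s≤s z≤n

  colour-cong : ∀ {h h′} (h-sym : Symmetric h) (h′-sym : Symmetric h′) x → (∀ y → h′ x y ≡ h x y) →
                colour (weighting h′ h′-sym) x ≡ colour (weighting h h-sym) x
  colour-cong _ _ x agree = Σv-cong (λ y → cong (λ b → if adj G x y then weight b else 0) (agree y))

  parity : Heavy → Fin n → Bool
  parity h x = ⨁ (λ y → adj G x y ∧ not (h x y))

  odd-colour : ∀ h h-sym x → odd (colour (weighting h h-sym) x) ≡ parity h x
  odd-colour h h-sym x =
    trans (cong odd (Σv≡∑ term)) (trans (odd-∑ term) (⊕∑.sum-cong-≗ (λ y → odd-term (adj G x y) (h x y))))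
    where
    term : Fin n → ℕ
    term y = if adj G x y then weight (h x y) else 0

    odd-term : ∀ a b → odd (if a then weight b else 0) ≡ a ∧ not b
    odd-term true  true  = refl
    odd-term true  false = refl
    odd-term false b     = refl

  parity-≢⇒colour-≢ : ∀ h h-sym {x y} → parity h x ≢ parity h y →
                      colour (weighting h h-sym) x ≢ colour (weighting h h-sym) y
  parity-≢⇒colour-≢ h h-sym {x} {y} parity≢ same =
    parity≢ (trans (sym (odd-colour h h-sym x)) (trans (cong odd same) (odd-colour h h-sym y)))

  ⨁-parity : ∀ h → Symmetric h → ⨁ (parity h) ≡ false
  ⨁-parity h h-sym = ⨁⨁-symmetric (λ x y → adj G x y ∧ not (h x y))
    (λ x y → cong₂ (λ a b → a ∧ not b) (adj-sym G x y) (h-sym x y))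
    (λ x → cong (_∧ not (h x x)) (adj-irref G x))

  edgeAt : Fin n → Fin n → Heavy
  edgeAt a c x y = (x == a ∧ y == c) xor (x == c ∧ y == a)

  flipEdge : Fin n → Fin n → Heavy → Heavy
  flipEdge a c h x y = h x y xor edgeAt a c x y

  flipEdge-sym : ∀ a c {h} → Symmetric h → Symmetric (flipEdge a c h)
  flipEdge-sym a c h-sym x y =
    cong₂ _xor_ (h-sym x y) (trans (xor-comm (x == a ∧ y == c) (x == c ∧ y == a))
                                   (cong₂ _xor_ (∧-comm (x == c) (y == a)) (∧-comm (x == a) (y == c))))

  flipEdge-away : ∀ a c h {z} → z ≢ a → z ≢ c → ∀ y → flipEdge a c h z y ≡ h z y
  flipEdge-away a c h {z} z≢a z≢c y =
    trans (cong₂ (λ p q → h z y xor ((p ∧ y == c) xor (q ∧ y == a))) (==-≢ z≢a) (==-≢ z≢c)) (xor-identityʳ _)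

  adj-∧-edge : ∀ {a c} → Adj G a c → ∀ x y → adj G x y ∧ (x == a ∧ y == c) ≡ (x == a ∧ y == c)
  adj-∧-edge {a} {c} ac x y with x ≟ a | y ≟ c
  ... | yes refl | yes refl = trans (∧-identityʳ _) (Equivalence.to T-≡ ac)
  ... | yes _    | no _     = ∧-zeroʳ _
  ... | no _     | _        = ∧-zeroʳ _

  ⨁-adj-∧-edgeAt : ∀ {a c} → Adj G a c → ∀ z → ⨁ (λ y → adj G z y ∧ edgeAt a c z y) ≡ (z == a) xor (z == c)
  ⨁-adj-∧-edgeAt {a} {c} ac z = begin
    ⨁ (λ y → adj G z y ∧ edgeAt a c z y)
      ≡⟨ ⊕∑.sum-cong-≗ (λ y → trans (∧-distribˡ-xor (adj G z y) _ _)
                                     (cong₂ _xor_ (adj-∧-edge ac z y) (adj-∧-edge (Adj-sym ac) z y))) ⟩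
    ⨁ (λ y → (z == a ∧ y == c) xor (z == c ∧ y == a))
      ≡⟨ ⊕∑.∑-distrib-+ (λ y → z == a ∧ y == c) (λ y → z == c ∧ y == a) ⟩
    ⨁ (λ y → z == a ∧ y == c) xor ⨁ (λ y → z == c ∧ y == a)
      ≡⟨ cong₂ _xor_ (⨁-∧-== (z == a) c) (⨁-∧-== (z == c) a) ⟩
    (z == a) xor (z == c) ∎
    where open ≡-Reasoning

  parity-flipEdge : ∀ {a c} → Adj G a c → ∀ h z →
                    parity (flipEdge a c h) z ≡ parity h z xor ((z == a) xor (z == c))
  parity-flipEdge {a} {c} ac h z = begin
    ⨁ (λ y → adj G z y ∧ not (h z y xor edgeAt a c z y))
      ≡⟨ ⊕∑.sum-cong-≗ (λ y → trans (cong (adj G z y ∧_) (not-distribˡ-xor (h z y) _))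
                                     (∧-distribˡ-xor (adj G z y) _ _)) ⟩
    ⨁ (λ y → (adj G z y ∧ not (h z y)) xor (adj G z y ∧ edgeAt a c z y))
      ≡⟨ ⊕∑.∑-distrib-+ (λ y → adj G z y ∧ not (h z y)) (λ y → adj G z y ∧ edgeAt a c z y) ⟩
    parity h z xor ⨁ (λ y → adj G z y ∧ edgeAt a c z y)
      ≡⟨ cong (parity h z xor_) (⨁-adj-∧-edgeAt ac z) ⟩
    parity h z xor ((z == a) xor (z == c)) ∎
    where open ≡-Reasoning

  flipWalk : ∀ {S x y} → Walk G S x y → Heavy → Heavy
  flipWalk (here _)             h = h
  flipWalk (step {x} {y} _ _ w) h = flipWalk w (flipEdge x y h)

  flipWalk-sym : ∀ {S x y} (w : Walk G S x y) {h} → Symmetric h → Symmetric (flipWalk w h)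
  flipWalk-sym (here _)             h-sym = h-sym
  flipWalk-sym (step {x} {y} _ _ w) h-sym = flipWalk-sym w (flipEdge-sym x y h-sym)

  walk-source : ∀ {S x y} → Walk G S x y → T (S x)
  walk-source (here Sx)     = Sx
  walk-source (step Sx _ _) = Sx

  outside≢inside : ∀ {S : Fin n → Bool} {z x} → S z ≡ false → T (S x) → z ≢ x
  outside≢inside Sz≡false Sx refl = subst T Sz≡false Sx

  flipWalk-away : ∀ {S x y} (w : Walk G S x y) h {z} → S z ≡ false → ∀ y′ → flipWalk w h z y′ ≡ h z y′
  flipWalk-away (here _)              h Sz y′ = refl
  flipWalk-away (step {x} {y} Sx _ w) h Sz y′ =
    trans (flipWalk-away w _ Sz y′)
          (flipEdge-away x y h (outside≢inside Sz Sx) (outside≢inside Sz (walk-source w)) y′)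

  parity-flipWalk : ∀ {S x y} (w : Walk G S x y) h z → parity (flipWalk w h) z ≡ parity h z xor ((z == x) xor (z == y))
  parity-flipWalk {x = x} (here _) h z =
    sym (trans (cong (parity h z xor_) (xor-same (z == x))) (xor-identityʳ _))
  parity-flipWalk (step {x} {y} {r} _ xy w) h z = begin
    parity (flipWalk w (flipEdge x y h)) z
      ≡⟨ parity-flipWalk w _ z ⟩
    parity (flipEdge x y h) z xor ((z == y) xor (z == r))
      ≡⟨ cong (_xor _) (parity-flipEdge xy h z) ⟩
    (parity h z xor ((z == x) xor (z == y))) xor ((z == y) xor (z == r))
      ≡⟨ xor-telescope (parity h z) (z == x) (z == y) (z == r) ⟩
    parity h z xor ((z == x) xor (z == r)) ∎
    where open ≡-Reasoning

  module Realise {S : Fin n → Bool} (S-connected : ConnectedOn G S) where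

    AgreeOutside : Heavy → Heavy → Set
    AgreeOutside h h′ = ∀ z → S z ≡ false → ∀ y → h′ z y ≡ h z y

    module Rooted (r : Fin n) (Sr : T (S r)) (defect : Fin n → Bool)
                  (defect-outside : ∀ x → S x ≡ false → defect x ≡ false) where

      flipToRoot : Fin n → Heavy → Heavy
      flipToRoot x h with T? (S x) | defect x
      ... | yes Sx | true = flipWalk (S-connected x r Sx Sr) h
      ... | _      | _    = h

      flipToRoot-sym : ∀ x {h} → Symmetric h → Symmetric (flipToRoot x h)
      flipToRoot-sym x h-sym with T? (S x) | defect x
      ... | yes Sx | true  = flipWalk-sym (S-connected x r Sx Sr) h-sym
      ... | yes _  | false = h-sym
      ... | no _   | _     = h-sym

      flipToRoot-away : ∀ x h → AgreeOutside h (flipToRoot x h)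
      flipToRoot-away x h with T? (S x) | defect x
      ... | yes Sx | true  = λ z Sz → flipWalk-away (S-connected x r Sx Sr) h Sz
      ... | yes _  | false = λ _ _ _ → refl
      ... | no _   | _     = λ _ _ _ → refl

      parity-flipToRoot : ∀ x h z → parity (flipToRoot x h) z ≡ parity h z xor (defect x ∧ ((z == x) xor (z == r)))
      parity-flipToRoot x h z with T? (S x) | defect x in dx
      ... | yes Sx | true  = parity-flipWalk (S-connected x r Sx Sr) h z
      ... | yes _  | false = sym (xor-identityʳ (parity h z))
      ... | no _   | false = sym (xor-identityʳ (parity h z))
      ... | no ¬Sx | true  with () ← trans (sym dx) (defect-outside x (¬-not (¬Sx ∘ Equivalence.from T-≡)))

      flipAllToRoot : ∀ {m} → (Fin m → Fin n) → Heavy → Heavy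
      flipAllToRoot {zero}  xs h = h
      flipAllToRoot {suc m} xs h = flipAllToRoot (xs ∘ suc) (flipToRoot (xs zero) h)

      flipAllToRoot-sym : ∀ {m} (xs : Fin m → Fin n) {h} → Symmetric h → Symmetric (flipAllToRoot xs h)
      flipAllToRoot-sym {zero}  xs h-sym = h-sym
      flipAllToRoot-sym {suc m} xs h-sym = flipAllToRoot-sym (xs ∘ suc) (flipToRoot-sym (xs zero) h-sym)

      flipAllToRoot-away : ∀ {m} (xs : Fin m → Fin n) h → AgreeOutside h (flipAllToRoot xs h)
      flipAllToRoot-away {zero}  xs h z Sz y = refl
      flipAllToRoot-away {suc m} xs h z Sz y =
        trans (flipAllToRoot-away (xs ∘ suc) _ z Sz y) (flipToRoot-away (xs zero) h z Sz y)

      parity-flipAllToRoot : ∀ {m} (xs : Fin m → Fin n) h z →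
                       parity (flipAllToRoot xs h) z
                         ≡ parity h z xor ⨁ (λ i → defect (xs i) ∧ ((z == xs i) xor (z == r)))
      parity-flipAllToRoot {zero}  xs h z = sym (xor-identityʳ (parity h z))
      parity-flipAllToRoot {suc m} xs h z =
        trans (parity-flipAllToRoot (xs ∘ suc) _ z)
              (trans (cong (_xor _) (parity-flipToRoot (xs zero) h z)) (xor-assoc (parity h z) _ _))

    -- Flip along a walk in S from every defective vertex to a root r: each defect is corrected once,
    -- and r is flipped once more for every defect, an even number of times since both parity patterns
    -- have even total.
    realise : ∀ h → Symmetric h → (t : Fin n → Bool) → ⨁ t ≡ false → (∀ z → S z ≡ false → parity h z ≡ t z) →
              Σ Heavy λ h′ → Symmetric h′ × AgreeOutside h h′ × (∀ z → parity h′ z ≡ t z)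
    realise h h-sym t ⨁t≡false parity-outside with any? (λ x → T? (S x))
    ... | no S-empty =
      h , h-sym , (λ _ _ _ → refl) , λ z → parity-outside z (¬-not (λ Sz → S-empty (z , Equivalence.from T-≡ Sz)))
    ... | yes (r , Sr) = flipAllToRoot id h , flipAllToRoot-sym id h-sym , flipAllToRoot-away id h , parity-realised
      where
      defect : Fin n → Bool
      defect x = parity h x xor t x

      open Rooted r Sr defect (λ x Sx → trans (cong (_xor t x) (parity-outside x Sx)) (xor-same (t x)))

      ⨁-defect : ⨁ defect ≡ false
      ⨁-defect = trans (⊕∑.∑-distrib-+ (parity h) t) (cong₂ _xor_ (⨁-parity h h-sym) ⨁t≡false)

      ⨁-flips : ∀ z → ⨁ (λ x → defect x ∧ ((z == x) xor (z == r))) ≡ defect z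
      ⨁-flips z = begin
        ⨁ (λ x → defect x ∧ ((z == x) xor (z == r)))
          ≡⟨ ⊕∑.sum-cong-≗ (λ x → ∧-distribˡ-xor (defect x) (z == x) (z == r)) ⟩
        ⨁ (λ x → (defect x ∧ z == x) xor (defect x ∧ z == r))
          ≡⟨ ⊕∑.∑-distrib-+ (λ x → defect x ∧ z == x) (λ x → defect x ∧ z == r) ⟩
        ⨁ (λ x → defect x ∧ z == x) xor ⨁ (λ x → defect x ∧ z == r)
          ≡⟨ cong₂ _xor_ (⨁-single _ z λ x x≢z → trans (cong (defect x ∧_) (==-≢ (x≢z ∘ sym))) (∧-zeroʳ _))
                         (sym (⊕∑.*-distribʳ-sum (z == r) defect)) ⟩
        (defect z ∧ z == z) xor (⨁ defect ∧ z == r)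
          ≡⟨ cong₂ (λ p q → (defect z ∧ p) xor (q ∧ z == r)) (==-refl z) ⨁-defect ⟩
        (defect z ∧ true) xor false
          ≡⟨ trans (xor-identityʳ _) (∧-identityʳ _) ⟩
        defect z ∎
        where open ≡-Reasoning

      parity-realised : ∀ z → parity (flipAllToRoot id h) z ≡ t z
      parity-realised z = begin
        parity (flipAllToRoot id h) z                                          ≡⟨ parity-flipAllToRoot id h z ⟩
        parity h z xor ⨁ (λ x → defect x ∧ ((z == x) xor (z == r)))    ≡⟨ cong (parity h z xor_) (⨁-flips z) ⟩
        parity h z xor (parity h z xor t z)                              ≡⟨ xor-sameˡ (parity h z) (t z) ⟩
        t z                                                              ∎
        where open ≡-Reasoning

module Bipartite {n} (G : Graph n) (side : Fin n → Bool) (bipartite : ∀ x y → Adj G x y → side x ≢ side y)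
                 (u : Fin n) where
  open Weightings G

  side₀ : Fin n → Bool
  side₀ x = side x xor side u

  side₀-adj : ∀ {x y} → Adj G x y → side₀ x ≢ side₀ y
  side₀-adj {x} {y} xy same = bipartite x y xy (xor-cancelʳ (side u) same)

  side₀-u : side₀ u ≡ false
  side₀-u = xor-same (side u)

  side₀-neighbour : ∀ {z} → Adj G u z → side₀ z ≡ true
  side₀-neighbour {z} uz =
    trans (cong (_xor side u) (¬-not (bipartite z u (Adj-sym uz)))) (xor-inverseˡ (side u))

  no-triangle : ∀ {x y z} → Adj G x y → Adj G y z → ¬ Adj G x z
  no-triangle {x} {y} {z} xy yz xz =
    bipartite x z xz (trans (¬-not (bipartite x y xy)) (sym (¬-not (bipartite z y (Adj-sym yz)))))

  side-parity⇒colour-≢ : ∀ h h-sym e {x y} → Adj G x y →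
                         parity h x ≡ side₀ x xor e → parity h y ≡ side₀ y xor e →
                         colour (weighting h h-sym) x ≢ colour (weighting h h-sym) y
  side-parity⇒colour-≢ h h-sym e xy parity-x parity-y =
    parity-≢⇒colour-≢ h h-sym (λ same → side₀-adj xy (xor-cancelʳ e (trans (sym parity-x) (trans same parity-y))))

  by-side-parity : Connected G → ∀ e → ⨁ (λ x → side₀ x xor e) ≡ false → HasVertexColouringWeighting G 2
  by-side-parity connected e ⨁≡false
    with Realise.realise connected (λ _ _ → false) (λ _ _ → refl) (λ x → side₀ x xor e) ⨁≡false (λ _ ())
  ... | h , h-sym , _ , parity≡ =
    weighting h h-sym , λ x y xy → side-parity⇒colour-≢ h h-sym e xy (parity≡ x) (parity≡ y)

  module AroundU (δ≥3 : MinDegreeAtLeast G 3) (u-min : MinDegreeVertex G u) where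

    -- e holds iff d(u) is even
    e : Bool
    e = not (⨁ (adj G u))

    other-neighbour : ∀ v → ∃ λ y → Adj G v y × y ≢ u
    other-neighbour v = another-neighbour v u (ℕ.≤-trans (ℕ.n≤1+n 2) (δ≥3 v))

    sel : Fin n → Fin n
    sel v = proj₁ (other-neighbour v)

    sel-adj : ∀ v → Adj G v (sel v)
    sel-adj v = proj₁ (proj₂ (other-neighbour v))

    sel-≢ : ∀ v → sel v ≢ u
    sel-≢ v = proj₂ (proj₂ (other-neighbour v))

    chosen : Heavy
    chosen x y = adj G u x ∧ y == sel x

    light : Heavy
    light x y = (x == u ∨ y == u) ∨ (e ∧ (chosen x y ∨ chosen y x))

    -- weight 2 exactly on the edges at N(u) other than those at u and, if e, the edges v—sel v
    heavy₀ : Heavy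
    heavy₀ x y = (adj G u x ∨ adj G u y) ∧ not (light x y)

    heavy₀-sym : Symmetric heavy₀
    heavy₀-sym x y =
      cong₂ (λ p q → p ∧ not q) (∨-comm (adj G u x) (adj G u y))
            (cong₂ (λ p q → p ∨ (e ∧ q)) (∨-comm (x == u) (y == u)) (∨-comm (chosen x y) (chosen y x)))

    heavy₀-u : ∀ y → heavy₀ u y ≡ false
    heavy₀-u y =
      trans (cong (λ p → (adj G u u ∨ adj G u y) ∧ not ((p ∨ y == u) ∨ (e ∧ (chosen u y ∨ chosen y u)))) (==-refl u))
            (∧-zeroʳ _)

    heavy₀-near : ∀ {z y} → Adj G u z → Adj G z y → heavy₀ z y ≡ not (y == u ∨ (e ∧ y == sel z))
    heavy₀-near {z} {y} uz zy
      rewrite Equivalence.to T-≡ uz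
            | ¬-not (no-triangle uz zy ∘ Equivalence.from T-≡)
            | ==-≢ (Adj⇒≢ (Adj-sym uz))
            | ∨-identityʳ (y == sel z) = refl

    light-near : ∀ {z} → Adj G u z → ∀ y → adj G z y ∧ not (heavy₀ z y) ≡ (y == u) xor (e ∧ y == sel z)
    light-near {z} uz y with adj G z y in zy
    ... | true = begin
      not (heavy₀ z y)                    ≡⟨ cong not (heavy₀-near uz (Equivalence.from T-≡ zy)) ⟩
      not (not (y == u ∨ (e ∧ y == sel z))) ≡⟨ not-involutive _ ⟩
      y == u ∨ (e ∧ y == sel z)           ≡⟨ ∨≡xor exclusive ⟩
      (y == u) xor (e ∧ y == sel z)       ∎
      where
      open ≡-Reasoning
      exclusive : ¬ (T (y == u) × T (e ∧ y == sel z))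
      exclusive (y==u , e∧y==sel) =
        sel-≢ z (trans (sym (==⇒≡ {x = y} (proj₂ (Equivalence.to (T-∧ {e}) e∧y==sel)))) (==⇒≡ {x = y} y==u))
    ... | false = sym (trans (cong₂ (λ p q → p xor (e ∧ q)) (==-≢ (adj≡false⇒≢ zy (Adj-sym uz)))
                                                        (==-≢ (adj≡false⇒≢ zy (sel-adj z))))
                             (∧-zeroʳ e))

    parity-heavy₀-near : ∀ {z} → Adj G u z → parity heavy₀ z ≡ not e
    parity-heavy₀-near {z} uz = begin
      parity heavy₀ z
        ≡⟨ ⊕∑.sum-cong-≗ (light-near uz) ⟩
      ⨁ (λ y → (y == u) xor (e ∧ y == sel z))
        ≡⟨ ⊕∑.∑-distrib-+ (λ y → y == u) (λ y → e ∧ y == sel z) ⟩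
      ⨁ (λ y → true ∧ y == u) xor ⨁ (λ y → e ∧ y == sel z)
        ≡⟨ cong₂ _xor_ (⨁-∧-== true u) (⨁-∧-== e (sel z)) ⟩
      true xor e ∎
      where open ≡-Reasoning

    colour₀ : Fin n → ℕ
    colour₀ = colour (weighting heavy₀ heavy₀-sym)

    colour₀-u : colour₀ u ≡ deg G u
    colour₀-u = Σv-cong (λ y → cong (λ b → if adj G u y then weight b else 0) (heavy₀-u y))

    colour₀-near : ∀ {v} → Adj G u v → deg G v + deg G v ≤ colour₀ v + 2
    colour₀-near {v} uv = begin
      deg G v + deg G v                     ≡⟨ cong₂ _+_ (Σv≡∑ (𝟙 ∘ adj G v)) (Σv≡∑ (𝟙 ∘ adj G v)) ⟩
      ∑ (𝟙 ∘ adj G v) + ∑ (𝟙 ∘ adj G v)     ≡⟨ ℕ∑.∑-distrib-+ (𝟙 ∘ adj G v) (𝟙 ∘ adj G v) ⟨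
      ∑ (λ y → 𝟙 (adj G v y) + 𝟙 (adj G v y)) ≤⟨ ∑-mono termwise ⟩
      ∑ (λ y → term y + (𝟙 (y == u) + 𝟙 (y == sel v)))
        ≡⟨ ℕ∑.∑-distrib-+ term _ ⟩
      ∑ term + ∑ (λ y → 𝟙 (y == u) + 𝟙 (y == sel v))
        ≡⟨ cong₂ _+_ (Σv≡∑ term) (sym (trans (ℕ∑.∑-distrib-+ (λ y → 𝟙 (y == u)) (λ y → 𝟙 (y == sel v)))
                                              (cong₂ _+_ (∑-𝟙-== u) (∑-𝟙-== (sel v))))) ⟨
      colour₀ v + 2                         ∎
      where
      open ℕ.≤-Reasoning
      term : Fin n → ℕ
      term y = if adj G v y then weight (heavy₀ v y) else 0

      light-bound : ∀ a e b → 2 ≤ weight (not (a ∨ (e ∧ b))) + (𝟙 a + 𝟙 b)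
      light-bound true  e     b     = s≤s (s≤s z≤n)
      light-bound false false b     = s≤s (s≤s z≤n)
      light-bound false true  true  = s≤s (s≤s z≤n)
      light-bound false true  false = s≤s (s≤s z≤n)

      termwise : ∀ y → 𝟙 (adj G v y) + 𝟙 (adj G v y) ≤ term y + (𝟙 (y == u) + 𝟙 (y == sel v))
      termwise y with adj G v y in vy
      ... | false = z≤n
      ... | true  = subst (λ b → 2 ≤ weight b + (𝟙 (y == u) + 𝟙 (y == sel v)))
                          (sym (heavy₀-near uv (Equivalence.from T-≡ vy)))
                          (light-bound (y == u) e (y == sel v))

    -- The colour of u is d(u), while each neighbour v has colour at least 2 d(v) - 2 ≥ 2 d(u) - 2 > d(u).
    colour₀-u<near : ∀ {v} → Adj G u v → colour₀ u < colour₀ v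
    colour₀-u<near {v} uv = subst (_< colour₀ v) (sym colour₀-u) (ℕ.+-cancelʳ-≤ 2 (suc (deg G u)) (colour₀ v) bound)
      where
      open ℕ.≤-Reasoning
      bound : suc (deg G u) + 2 ≤ colour₀ v + 2
      bound = begin
        suc (deg G u) + 2     ≡⟨ ℕ.+-comm (suc (deg G u)) 2 ⟩
        3 + deg G u           ≤⟨ ℕ.+-monoˡ-≤ (deg G u) (δ≥3 u) ⟩
        deg G u + deg G u     ≤⟨ ℕ.+-mono-≤ (u-min v) (u-min v) ⟩
        deg G v + deg G v     ≤⟨ colour₀-near uv ⟩
        colour₀ v + 2         ∎

    target : Fin n → Bool
    target x = (side₀ x xor e) xor (x == u)

    target-away : ∀ {z} → z ≢ u → target z ≡ side₀ z xor e
    target-away {z} z≢u = trans (cong ((side₀ z xor e) xor_) (==-≢ z≢u)) (xor-identityʳ (side₀ z xor e))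

    ⨁-target : ⨁ (λ x → side₀ x xor e) ≡ true → ⨁ target ≡ false
    ⨁-target ⨁≡true =
      trans (⊕∑.∑-distrib-+ (λ x → side₀ x xor e) (λ x → x == u)) (cong₂ _xor_ ⨁≡true (⨁-∧-== true u))

    deleted-u : deleteClosedNbhd G u u ≡ false
    deleted-u = trans (cong (λ b → not (adj G u u) ∧ not b) (==-refl u)) (∧-zeroʳ _)

    deleted-neighbour : ∀ {v} → Adj G u v → deleteClosedNbhd G u v ≡ false
    deleted-neighbour {v} uv = cong (λ b → not b ∧ not (u == v)) (Equivalence.to T-≡ uv)

    deleted⇒neighbour : ∀ {z} → deleteClosedNbhd G u z ≡ false → z ≢ u → Adj G u z
    deleted⇒neighbour {z} outside z≢u with T? (adj G u z)
    ... | yes uz  = uz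
    ... | no ¬uz with () ← trans (sym outside) (cong₂ (λ a b → not a ∧ not b) (¬-not (¬uz ∘ Equivalence.from T-≡))
                                                                       (==-≢ (≢-sym z≢u)))

    parity₀-u : parity heavy₀ u ≡ target u
    parity₀-u = begin
      parity heavy₀ u        ≡⟨ ⊕∑.sum-cong-≗ (λ y → trans (cong (λ b → adj G u y ∧ not b) (heavy₀-u y))
                                                        (∧-identityʳ _)) ⟩
      ⨁ (adj G u)            ≡⟨ not-involutive _ ⟨
      not e                  ≡⟨ xor-comm true e ⟩
      e xor true             ≡⟨ cong₂ (λ a b → (a xor e) xor b) side₀-u (==-refl u) ⟨
      target u               ∎
      where open ≡-Reasoning

    parity₀-outside : ∀ z → deleteClosedNbhd G u z ≡ false → parity heavy₀ z ≡ target z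
    parity₀-outside z outside = by-cases (z ≟ u)
      where
      by-cases : Dec (z ≡ u) → parity heavy₀ z ≡ target z
      by-cases (yes refl) = parity₀-u
      by-cases (no z≢u)   =
        trans (parity-heavy₀-near uz) (sym (trans (target-away z≢u) (cong (_xor e) (side₀-neighbour uz))))
        where uz = deleted⇒neighbour outside z≢u

    -- Reweighting inside G - u - N(u) keeps the colours of u and its neighbours.
    around-u : ConnectedOn G (deleteClosedNbhd G u) → (∀ b → ⨁ (λ x → side₀ x xor b) ≡ true) →
               HasVertexColouringWeighting G 2
    around-u S-connected ⨁≡true
      with Realise.realise S-connected heavy₀ heavy₀-sym target (⨁-target (⨁≡true e)) parity₀-outside
    ... | h , h-sym , agree , parity≡ = weighting h h-sym , proper
      where
      colour-h : Fin n → ℕ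
      colour-h = colour (weighting h h-sym)

      colour-h-u<near : ∀ {v} → Adj G u v → colour-h u < colour-h v
      colour-h-u<near {v} uv =
        subst₂ _<_ (sym (colour-cong heavy₀-sym h-sym u (agree u deleted-u)))
                   (sym (colour-cong heavy₀-sym h-sym v (agree v (deleted-neighbour uv))))
                   (colour₀-u<near uv)

      proper : ∀ x y → Adj G x y → colour-h x ≢ colour-h y
      proper x y xy with x ≟ u | y ≟ u
      ... | yes refl | _        = ℕ.<⇒≢ (colour-h-u<near xy)
      ... | no _     | yes refl = ≢-sym (ℕ.<⇒≢ (colour-h-u<near (Adj-sym xy)))
      ... | no x≢u   | no y≢u   =
        side-parity⇒colour-≢ h h-sym e xy (trans (parity≡ x) (target-away x≢u))
                                          (trans (parity≡ y) (target-away y≢u))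

  colouring : Connected G → MinDegreeAtLeast G 3 → MinDegreeVertex G u → ConnectedOn G (deleteClosedNbhd G u) →
              HasVertexColouringWeighting G 2
  colouring connected δ≥3 u-min S-connected
    with ⨁ (λ x → side₀ x xor false) in total₀ | ⨁ (λ x → side₀ x xor true) in total₁
  ... | false | _     = by-side-parity connected false total₀
  ... | true  | false = by-side-parity connected true total₁
  ... | true  | true  = AroundU.around-u δ≥3 u-min S-connected λ { false → total₀ ; true → total₁ }

corollary3p3 : (n : ℕ) (G : Graph n) → Bipartite G → Connected G → MinDegreeAtLeast G 3 → Σ (Fin n) (λ u → MinDegreeVertex G u × ConnectedOn G (deleteClosedNbhd G u)) → HasVertexColouringWeighting G 2
corollary3p3 n G (side , bipartite) connected δ≥3 (u , u-min , S-connected) =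
  Bipartite.colouring G side bipartite u connected δ≥3 u-min S-connected
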